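{- Let $G=(V,E)$ be a directed graph on $n$ vertices with real edge weights in $[1,W]$, let $k\ge 2$ be an integer, $L>0$ and $\epsilon\in(0,1/(2k-2)]$. Then the edge set $\hat{E}$ returned by $\mathrm{Cover}(G,k,L,\epsilon)$ has size $O(n^{1+1/k})$.
   Context: Notation: for $U\subseteq V$, $G[U]$ is the induced subgraph, $d_U(x\to y)$ the shortest directed path length in $G[U]$, $d_U(x\leftrightarrows y)=d_U(x\to y)+d_U(y\to x)$, $Ball_U(u,r)=\{v\in U: d_U(u\leftrightarrows v)<r\}$ and $\overline{Ball}_U(u,r)=\{v\in U: d_U(u\leftrightarrows v)\le r\}$; when $U=V$ the subscript is dropped. For $u\in V$, $R(u)$ is the roundtrip distance in $G$ from $u$ to the $\lceil n^{1-1/k}\rceil$-th vertex when all vertices are sorted by increasing roundtrip distance to $u$ in $G$ (with $u$ first). Procedure $\mathrm{Cover}(G,k,L,\epsilon)$: set $U\gets V$, $\hat{E}\gets\emptyset$. While $U\ne\emptyset$: pick $u\in U$ maximizing $R(u)$ (with $R$ always computed in the original $G$); set $step\gets\min\{R(u)/(k-1),L\}$; let $h$ be the minimum positive integer with $|Ball_U(u,h\cdot step)|<n^{h/k}$; add to $\hat{E}$ the edges of an outward shortest path tree in $G[U]$ from $u$ to all vertices of $Ball_U(u,h\cdot step)$ and an inward shortest path tree in $G[U]$ from all vertices of $Ball_U(u,h\cdot step)$ to $u$; remove $\overline{Ball}_U(u,(h-1)step)$ from $U$. Return $\hat{E}$.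
   Formalization: The edge weights, the bound W and the parameters L and ε are rational rather than real. -}

module Defs where

open import Data.Nat as ℕ using (ℕ; zero; suc)
open import Data.Integer using (+_)
open import Data.Rational as ℚ using (ℚ; 0ℚ; 1ℚ; _/_)
open import Data.Fin using (Fin; combine)
open import Data.Fin.Subset using (Subset; _∈_; _∉_; _∪_; ∣_∣; ⊤; ⊥)
open import Data.Maybe using (Maybe; just; nothing)
open import Data.Product using (Σ; ∃; ∃-syntax; _×_; _,_)
open import Relation.Binary.PropositionalEquality using (_≡_; _≢_)
open import Relation.Nullary using (¬_)
open import Function.Bundles using (_⇔_)

-- Weighted directed graphs on vertex set Fin n.
-- w a b ≡ just c  : there is an edge a → b of weight c
-- w a b ≡ nothing : there is no edge a → b
Graph : ℕ → Set
Graph n = Fin n → Fin n → Maybe ℚ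

-- Extended rationals: nothing = +∞ (used for distances).
ℚ∞ : Set
ℚ∞ = Maybe ℚ

_+∞_ : ℚ∞ → ℚ∞ → ℚ∞
just a +∞ just b = just (a ℚ.+ b)
_      +∞ _      = nothing

data _≤∞_ : ℚ∞ → ℚ∞ → Set where
  fin≤fin : ∀ {a b} → a ℚ.≤ b → just a ≤∞ just b
  any≤∞   : ∀ {a} → a ≤∞ nothing

data _<∞_ : ℚ∞ → ℚ∞ → Set where
  fin<fin : ∀ {a b} → a ℚ.< b → just a <∞ just b
  fin<∞   : ∀ {a} → just a <∞ nothing

ℕ→ℚ : ℕ → ℚ
ℕ→ℚ m = + m / 1

-- q / m  (m ≥ 1; the case m = 0 is never used)
divℕ : ℚ → ℕ → ℚ
divℕ q zero    = q
divℕ q (suc j) = q ℚ.* (+ 1 / suc j)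

min∞ : ℚ∞ → ℚ → ℚ
min∞ nothing  l = l
min∞ (just a) l = a ℚ.⊓ l

module _ {n : ℕ} (G : Graph n) where

  data Walk (U : Subset n) : Fin n → Fin n → ℚ → Set where
    here : ∀ {x} → x ∈ U → Walk U x x 0ℚ
    step : ∀ {x z y c l} → x ∈ U → G x z ≡ just c →
           Walk U z y l → Walk U x y (c ℚ.+ l)

  Dist : Subset n → Fin n → Fin n → ℚ∞ → Set
  Dist U x y (just d) = Walk U x y d × (∀ l → Walk U x y l → d ℚ.≤ l)
  Dist U x y nothing  = ∀ l → ¬ Walk U x y l

  RT : Subset n → Fin n → Fin n → ℚ∞ → Set
  RT U x y d = ∃[ d₁ ] ∃[ d₂ ] (Dist U x y d₁ × Dist U y x d₂ × d ≡ d₁ +∞ d₂)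

  InBall : Subset n → Fin n → ℚ → Fin n → Set
  InBall U u r v = v ∈ U × ∃[ d ] (RT U u v d × d <∞ just r)

  InCBall : Subset n → Fin n → ℚ → Fin n → Set
  InCBall U u r v = v ∈ U × ∃[ d ] (RT U u v d × d ≤∞ just r)

  Represents : (Fin n → Set) → Subset n → Set
  Represents P S = ∀ v → (v ∈ S ⇔ P v)

  HasCard : (Fin n → Set) → ℕ → Set
  HasCard P c = ∃[ S ] (Represents P S × ∣ S ∣ ≡ c)

  -- m = ⌈ n^{1-1/k} ⌉ : least m with n^{k-1} ≤ m^k
  IsCeilRoot : ℕ → ℕ → Set
  IsCeilRoot k m = (n ℕ.^ (k ℕ.∸ 1) ℕ.≤ m ℕ.^ k)
                 × (∀ j → n ℕ.^ (k ℕ.∸ 1) ℕ.≤ j ℕ.^ k → m ℕ.≤ j)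

  -- R(u) = r : r is the roundtrip distance (in G) from u to the m-th vertex
  -- in the list of all vertices sorted by roundtrip distance to u, where
  -- m = ⌈n^{1-1/k}⌉; i.e. r is the m-th order statistic of the multiset
  -- { d(u ⇆ v) | v ∈ V }:  #{v | d < r} < m ≤ #{v | d ≤ r}.
  IsR : ℕ → Fin n → ℚ∞ → Set
  IsR k u r = ∃[ m ] (IsCeilRoot k m
            × ∃[ a ] ∃[ b ]
                ( HasCard (λ v → ∃[ d ] (RT ⊤ u v d × d <∞ r)) a
                × HasCard (λ v → ∃[ d ] (RT ⊤ u v d × d ≤∞ r)) b
                × a ℕ.< m × m ℕ.≤ b))

  EdgeSet : Set
  EdgeSet = Subset (n ℕ.* n)

  edge : Fin n → Fin n → Fin (n ℕ.* n)
  edge a b = combine {n} {n} a b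

  OutSPT : Subset n → Fin n → Subset n → EdgeSet → Set
  OutSPT U u B T =
      (∀ a b → edge a b ∈ T →
         a ∈ B × b ∈ B × b ≢ u ×
         ∃[ c ] ∃[ da ] ∃[ db ]
           (G a b ≡ just c × Dist U u a (just da) × Dist U u b (just db)
            × db ≡ da ℚ.+ c))
    × (∀ b → b ∈ B → b ≢ u → ∃[ a ] (edge a b ∈ T))
    × (∀ a a′ b → edge a b ∈ T → edge a′ b ∈ T → a ≡ a′)

  InSPT : Subset n → Fin n → Subset n → EdgeSet → Set
  InSPT U u B T =
      (∀ b a → edge b a ∈ T →
         a ∈ B × b ∈ B × b ≢ u ×
         ∃[ c ] ∃[ da ] ∃[ db ]
           (G b a ≡ just c × Dist U a u (just da) × Dist U b u (just db)
            × db ≡ c ℚ.+ da))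
    × (∀ b → b ∈ B → b ≢ u → ∃[ a ] (edge b a ∈ T))
    × (∀ a a′ b → edge b a ∈ T → edge b a′ ∈ T → a ≡ a′)

  stepLen : ℕ → ℚ → ℚ∞ → ℚ
  stepLen k L nothing  = L
  stepLen k L (just r) = min∞ (just (divℕ r (k ℕ.∸ 1))) L

  CoverStep : ℕ → ℚ → Subset n → EdgeSet → Subset n → EdgeSet → Set
  CoverStep k L U Ê U′ Ê′ =
    ∃[ u ] (u ∈ U × ∃[ r ] (IsR k u r
      × (∀ u₁ r₁ → u₁ ∈ U → IsR k u₁ r₁ → r₁ ≤∞ r)
      × let s = stepLen k L r in
        ∃[ h ] (1 ℕ.≤ h
        -- h is the least positive integer with |Ball_U(u, h·step)| < n^{h/k}
        × (∀ j c → 1 ℕ.≤ j → j ℕ.< h →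
             HasCard (InBall U u (ℕ→ℚ j ℚ.* s)) c → n ℕ.^ j ℕ.≤ c ℕ.^ k)
        × ∃[ B ] (Represents (InBall U u (ℕ→ℚ h ℚ.* s)) B
                 × ∣ B ∣ ℕ.^ k ℕ.< n ℕ.^ h
        × ∃[ Tout ] ∃[ Tin ] (OutSPT U u B Tout × InSPT U u B Tin
        × Ê′ ≡ (Ê ∪ Tout) ∪ Tin
        × Represents (λ v → v ∈ U × ¬ InCBall U u (ℕ→ℚ (h ℕ.∸ 1) ℚ.* s) v) U′)))))

  -- CoverRun k L U Ê Ê′ : the while-loop, started with current vertex set U
  -- and current edge set Ê, can terminate returning Ê′ (for some choice of
  -- ties and of shortest path trees).
  data CoverRun (k : ℕ) (L : ℚ) : Subset n → EdgeSet → EdgeSet → Set where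
    done : ∀ {U Ê} → (∀ v → v ∉ U) → CoverRun k L U Ê Ê
    iter : ∀ {U Ê U′ Ê₁ Ê′} → CoverStep k L U Ê U′ Ê₁ →
           CoverRun k L U′ Ê₁ Ê′ → CoverRun k L U Ê Ê′

  -- Ê is an output of Cover(G, k, L, ε) (ε is not used by the procedure).
  CoverOutput : ℕ → ℚ → ℚ → EdgeSet → Set
  CoverOutput k L ε Ê = CoverRun k L ⊤ ⊥ Ê

{-# OPTIONS --safe #-}
module Submission where

-- Fix c with n ≤ c ^ k (c = ⌊n^{1/k}⌋ + 1).  An iteration with centre u and index h adds two
-- shortest path trees on the ball B of radius h·step, so at most 2|B| edges with |B|^k < n^h,
-- and removes the closed ball of radius (h-1)·step.  By minimality of h the open ball of that
-- radius already has at least n^{(h-1)/k} vertices (for h = 1 it contains u), so |B| is less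
-- than c times the number of removed vertices.  Hence the potential |Ê| + 2c|U| never
-- increases, and the output has at most 2cn ≤ 4 n^{1+1/k} edges.

open import Defs
open import Data.Bool.Properties using (T-≡)
open import Data.Fin using (Fin; zero; suc; combine; quotient; remainder)
open import Data.Fin.Properties using (combine-remQuot)
import Data.Fin.Properties as Fin
open import Data.Fin.Subset
  using (Subset; inside; outside; _∈_; _⊆_; _∪_; _∩_; _─_; _-_; ⊤; ⊥; ∣_∣)
open import Data.Fin.Subset.Properties
  using (_∈?_; p⊆q⇒∣p∣≤∣q∣; ∣p∩q∣≤∣q∣; x∈p∩q⁺; x∈p∧x∉q⇒x∈p─q;
         x∈p∧x≢y⇒x∈p-y; x∈p⇒∣p-x∣<∣p∣; ∣⊥∣≡0; ∣⊤∣≡n)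
open import Data.Integer as ℤ using (+_)
open import Data.Integer.Properties using (*-monoʳ-≤-nonNeg)
open import Data.Maybe using (just; nothing)
open import Data.Nat
  using (ℕ; zero; suc; z≤n; s≤s; s≤s⁻¹; _≤_; _<_; _<?_; _^_; _*_; _+_; _∸_; NonZero; >-nonZero)
open import Data.Nat.Coprimality as Coprime using (1-coprimeTo)
open import Data.Nat.Properties
open import Data.Nat.Tactic.RingSolver using (solve-∀)
open import Data.Product using (∃-syntax; _×_; _,_; proj₁; proj₂)
open import Data.Rational as ℚ using (ℚ; 0ℚ; 1ℚ)
import Data.Rational.Properties as ℚₚ
open import Data.Vec using (tabulate; lookup; []; _∷_; here; there)
open import Data.Vec.Properties using (lookup∘tabulate; []=⇒lookup; lookup⇒[]=)
open import Function using (_∘_)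
open import Function.Bundles using (_⇔_; mk⇔; Equivalence)
open import Relation.Binary.PropositionalEquality
  using (_≡_; refl; sym; trans; cong; cong₂; subst; module ≡-Reasoning)
open import Relation.Nullary using (yes; no; contradiction)
open import Relation.Nullary.Decidable as Dec using (isYes; toWitness; fromWitness)
open import Relation.Unary using (Decidable)

^-distribʳ-* : ∀ m n o → (m * n) ^ o ≡ m ^ o * n ^ o
^-distribʳ-* m n zero    = refl
^-distribʳ-* m n (suc o) = begin
  m * n * (m * n) ^ o        ≡⟨ cong (m * n *_) (^-distribʳ-* m n o) ⟩
  m * n * (m ^ o * n ^ o)    ≡⟨ interchange m n (m ^ o) (n ^ o) ⟩
  m * m ^ o * (n * n ^ o)    ∎
  where
  open ≡-Reasoning
  interchange : ∀ a b c d → a * b * (c * d) ≡ a * c * (b * d)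
  interchange = solve-∀

^-cancelˡ-< : ∀ {m n} o → m ^ o < n ^ o → m < n
^-cancelˡ-< {m} {n} o mᵒ<nᵒ with m <? n
... | yes m<n = m<n
... | no m≮n = contradiction (^-monoˡ-≤ o (≮⇒≥ m≮n)) (<⇒≱ mᵒ<nᵒ)

floor-root : ∀ k .{{_ : NonZero k}} m → ∃[ t ] t ^ k ≤ m × m < suc t ^ k
floor-root (suc k) zero = 0 , z≤n , m^n>0 1 (suc k)
floor-root k (suc m) with floor-root k m
... | t , tᵏ≤m , m<[1+t]ᵏ with suc m <? suc t ^ k
...   | yes 1+m<[1+t]ᵏ = t , m≤n⇒m≤1+n tᵏ≤m , 1+m<[1+t]ᵏ
...   | no 1+m≮[1+t]ᵏ  = suc t , ≮⇒≥ 1+m≮[1+t]ᵏ , ≤-<-trans m<[1+t]ᵏ (^-monoˡ-< k (n<1+n (suc t)))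

[1+t]*n≤2*t*n : ∀ k t n → n < suc t ^ k → suc t * n ≤ 2 * t * n
[1+t]*n≤2*t*n k zero    zero    _      = z≤n
[1+t]*n≤2*t*n k zero    (suc n) 1+n<1ᵏ = contradiction (s≤s⁻¹ (subst (suc n <_) (^-zeroˡ k) 1+n<1ᵏ)) n≮0
[1+t]*n≤2*t*n k (suc t) n       _      = *-monoˡ-≤ n (begin
  suc (suc t)      ≡⟨ +-comm 1 (suc t) ⟩
  suc t + 1        ≤⟨ +-monoʳ-≤ (suc t) (s≤s z≤n) ⟩
  suc t + suc t    ≡⟨ cong (_+_ (suc t)) (sym (+-identityʳ (suc t))) ⟩
  2 * suc t        ∎)
  where open ≤-Reasoning

m≤2[1+t]n⇒mᵏ≤4ᵏnᵏ⁺¹ : ∀ k {t n m} → t ^ k ≤ n → n < suc t ^ k → m ≤ 2 * suc t * n →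
                      m ^ k ≤ 4 ^ k * n ^ (k + 1)
m≤2[1+t]n⇒mᵏ≤4ᵏnᵏ⁺¹ k {t} {n} {m} tᵏ≤n n<[1+t]ᵏ m≤2[1+t]n = begin
  m ^ k                    ≤⟨ ^-monoˡ-≤ k m≤4tn ⟩
  (4 * (t * n)) ^ k        ≡⟨ ^-distribʳ-* 4 (t * n) k ⟩
  4 ^ k * (t * n) ^ k      ≡⟨ cong (4 ^ k *_) (^-distribʳ-* t n k) ⟩
  4 ^ k * (t ^ k * n ^ k)  ≤⟨ *-monoʳ-≤ (4 ^ k) (*-monoˡ-≤ (n ^ k) tᵏ≤n) ⟩
  4 ^ k * n ^ (1 + k)      ≡⟨ cong (λ e → 4 ^ k * n ^ e) (+-comm 1 k) ⟩
  4 ^ k * n ^ (k + 1)      ∎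
  where
  open ≤-Reasoning
  m≤4tn : m ≤ 4 * (t * n)
  m≤4tn = begin
    m                    ≤⟨ m≤2[1+t]n ⟩
    2 * suc t * n        ≡⟨ *-assoc 2 (suc t) n ⟩
    2 * (suc t * n)      ≤⟨ *-monoʳ-≤ 2 ([1+t]*n≤2*t*n k t n n<[1+t]ᵏ) ⟩
    2 * (2 * t * n)      ≡⟨ regroup t n ⟩
    4 * (t * n)          ∎
    where
    regroup : ∀ t n → 2 * (2 * t * n) ≡ 4 * (t * n)
    regroup = solve-∀

∣p∪q∣≤∣p∣+∣q∣ : ∀ {n} (p q : Subset n) → ∣ p ∪ q ∣ ≤ ∣ p ∣ + ∣ q ∣
∣p∪q∣≤∣p∣+∣q∣ []            []            = z≤n
∣p∪q∣≤∣p∣+∣q∣ (outside ∷ p) (outside ∷ q) = ∣p∪q∣≤∣p∣+∣q∣ p q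
∣p∪q∣≤∣p∣+∣q∣ (outside ∷ p) (inside  ∷ q) = ≤-trans (s≤s (∣p∪q∣≤∣p∣+∣q∣ p q)) (≤-reflexive (sym (+-suc ∣ p ∣ ∣ q ∣)))
∣p∪q∣≤∣p∣+∣q∣ (inside  ∷ p) (outside ∷ q) = s≤s (∣p∪q∣≤∣p∣+∣q∣ p q)
∣p∪q∣≤∣p∣+∣q∣ (inside  ∷ p) (inside  ∷ q) = s≤s (≤-trans (∣p∪q∣≤∣p∣+∣q∣ p q) (+-monoʳ-≤ ∣ p ∣ (n≤1+n ∣ q ∣)))

∣p∣≡∣p∩q∣+∣p─q∣ : ∀ {n} (p q : Subset n) → ∣ p ∣ ≡ ∣ p ∩ q ∣ + ∣ p ─ q ∣
∣p∣≡∣p∩q∣+∣p─q∣ []            []            = refl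
∣p∣≡∣p∩q∣+∣p─q∣ (outside ∷ p) (inside  ∷ q) = ∣p∣≡∣p∩q∣+∣p─q∣ p q
∣p∣≡∣p∩q∣+∣p─q∣ (outside ∷ p) (outside ∷ q) = ∣p∣≡∣p∩q∣+∣p─q∣ p q
∣p∣≡∣p∩q∣+∣p─q∣ (inside  ∷ p) (inside  ∷ q) = cong suc (∣p∣≡∣p∩q∣+∣p─q∣ p q)
∣p∣≡∣p∩q∣+∣p─q∣ (inside  ∷ p) (outside ∷ q) = trans (cong suc (∣p∣≡∣p∩q∣+∣p─q∣ p q)) (sym (+-suc _ _))

q⊆p⇒∣p∣≡∣q∣+∣p─q∣ : ∀ {n} {p q : Subset n} → q ⊆ p → ∣ p ∣ ≡ ∣ q ∣ + ∣ p ─ q ∣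
q⊆p⇒∣p∣≡∣q∣+∣p─q∣ {p = p} {q} q⊆p = trans (∣p∣≡∣p∩q∣+∣p─q∣ p q) (cong (_+ ∣ p ─ q ∣) ∣p∩q∣≡∣q∣)
  where
  ∣p∩q∣≡∣q∣ : ∣ p ∩ q ∣ ≡ ∣ q ∣
  ∣p∩q∣≡∣q∣ = ≤-antisym (∣p∩q∣≤∣q∣ p q) (p⊆q⇒∣p∣≤∣q∣ (λ x∈q → x∈p∩q⁺ (q⊆p x∈q , x∈q)))

injectiveOn⇒∣p∣≤∣q∣ : ∀ {m n} {p : Subset m} {q : Subset n} (f : Fin m → Fin n) →
                      (∀ {x} → x ∈ p → f x ∈ q) →
                      (∀ {x y} → x ∈ p → y ∈ p → f x ≡ f y → x ≡ y) → ∣ p ∣ ≤ ∣ q ∣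
injectiveOn⇒∣p∣≤∣q∣ {p = []}          f _    _   = z≤n
injectiveOn⇒∣p∣≤∣q∣ {p = outside ∷ p} f into inj =
  injectiveOn⇒∣p∣≤∣q∣ (f ∘ suc) (into ∘ there)
    (λ x∈ y∈ → Fin.suc-injective ∘ inj (there x∈) (there y∈))
injectiveOn⇒∣p∣≤∣q∣ {p = inside ∷ p} {q} f into inj = begin-strict
  ∣ p ∣              ≤⟨ injectiveOn⇒∣p∣≤∣q∣ (f ∘ suc) into′
                          (λ x∈ y∈ → Fin.suc-injective ∘ inj (there x∈) (there y∈)) ⟩
  ∣ q - f zero ∣     <⟨ x∈p⇒∣p-x∣<∣p∣ (into here) ⟩
  ∣ q ∣              ∎
  where
  open ≤-Reasoning
  into′ : ∀ {x} → x ∈ p → f (suc x) ∈ q - f zero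
  into′ x∈ = x∈p∧x≢y⇒x∈p-y (into (there x∈)) (Fin.0≢1+n ∘ sym ∘ inj (there x∈) here)

decSubset : ∀ {n} {P : Fin n → Set} → Decidable P → Subset n
decSubset P? = tabulate (isYes ∘ P?)

∈decSubset⇔ : ∀ {n} {P : Fin n → Set} (P? : Decidable P) v → v ∈ decSubset P? ⇔ P v
∈decSubset⇔ P? v = mk⇔
  (λ v∈ → toWitness {a? = P? v} (Equivalence.from T-≡ (trans (sym lookup≡) ([]=⇒lookup v∈))))
  (λ Pv → lookup⇒[]= v _ (trans lookup≡ (Equivalence.to T-≡ (fromWitness {a? = P? v} Pv))))
  where
  lookup≡ : lookup (decSubset P?) v ≡ isYes (P? v)
  lookup≡ = lookup∘tabulate (isYes ∘ P?) v

module _ {n} {T : Subset (n * n)} {B : Subset n} where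
  private
    source target : Fin (n * n) → Fin n
    source = quotient {n} n
    target = remainder {n} n

    ∈T⇒combine∈T : ∀ {e} → e ∈ T → combine (source e) (target e) ∈ T
    ∈T⇒combine∈T {e} = subst (_∈ T) (sym (combine-remQuot {n} n e))

    source-target-injective : ∀ {e e′} → source e ≡ source e′ → target e ≡ target e′ → e ≡ e′
    source-target-injective {e} {e′} s≡ t≡ = begin
      e                                ≡⟨ combine-remQuot {n} n e ⟨
      combine (source e) (target e)    ≡⟨ cong₂ combine s≡ t≡ ⟩
      combine (source e′) (target e′)  ≡⟨ combine-remQuot {n} n e′ ⟩
      e′                               ∎
      where open ≡-Reasoning

  unique-in-edge⇒∣T∣≤∣B∣ : (∀ {a b : Fin n} → combine a b ∈ T → b ∈ B) →
                           (∀ {a a′ b : Fin n} → combine a b ∈ T → combine a′ b ∈ T → a ≡ a′) →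
                           ∣ T ∣ ≤ ∣ B ∣
  unique-in-edge⇒∣T∣≤∣B∣ head∈B unique-in =
    injectiveOn⇒∣p∣≤∣q∣ target (head∈B ∘ ∈T⇒combine∈T) λ {_} {e′} e∈ e′∈ t≡ →
      source-target-injective
        (unique-in (∈T⇒combine∈T e∈) (subst (λ b → combine (source e′) b ∈ T) (sym t≡) (∈T⇒combine∈T e′∈)))
        t≡

  unique-out-edge⇒∣T∣≤∣B∣ : (∀ {a b : Fin n} → combine a b ∈ T → a ∈ B) →
                            (∀ {a b b′ : Fin n} → combine a b ∈ T → combine a b′ ∈ T → b ≡ b′) →
                            ∣ T ∣ ≤ ∣ B ∣
  unique-out-edge⇒∣T∣≤∣B∣ tail∈B unique-out =
    injectiveOn⇒∣p∣≤∣q∣ source (tail∈B ∘ ∈T⇒combine∈T) λ {_} {e′} e∈ e′∈ s≡ →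
      source-target-injective s≡
        (unique-out (∈T⇒combine∈T e∈) (subst (λ a → combine a (target e′) ∈ T) (sym s≡) (∈T⇒combine∈T e′∈)))

ℕ→ℚ-mono-≤ : ∀ {m n} → m ≤ n → ℕ→ℚ m ℚ.≤ ℕ→ℚ n
ℕ→ℚ-mono-≤ {m} {n} m≤n
  rewrite ℚₚ.normalize-coprime (Coprime.sym (1-coprimeTo m))
        | ℚₚ.normalize-coprime (Coprime.sym (1-coprimeTo n))
  = ℚ.*≤* (*-monoʳ-≤-nonNeg (+ 1) (ℤ.+≤+ m≤n))

-- The sign of s is unknown, but a nonnegative value below j·s forces s > 0.
a<j*s⇒a<[1+j]*s : ∀ {a s} j → 0ℚ ℚ.≤ a → a ℚ.< ℕ→ℚ j ℚ.* s → a ℚ.< ℕ→ℚ (suc j) ℚ.* s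
a<j*s⇒a<[1+j]*s {a} {s} j 0≤a a<js with 0ℚ ℚ.≤? s
... | yes 0≤s = ℚₚ.<-≤-trans a<js (ℚₚ.*-monoʳ-≤-nonNeg s {{ℚ.nonNegative 0≤s}} (ℕ→ℚ-mono-≤ (n≤1+n j)))
... | no 0≰s  = contradiction (ℚₚ.≤-<-trans js≤0 (ℚₚ.≤-<-trans 0≤a a<js)) (ℚₚ.<-irrefl refl)
  where
  js≤0 : ℕ→ℚ j ℚ.* s ℚ.≤ 0ℚ
  js≤0 = ℚₚ.nonPositive⁻¹ _ {{ℚₚ.nonNeg*nonPos⇒nonPos (ℕ→ℚ j) {{ℚₚ.normalize-nonNeg j 1}}
                                s {{ℚ.nonPositive (ℚₚ.<⇒≤ (ℚₚ.≰⇒> 0≰s))}}}}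

module _ {n} (G : Graph n) where

  Dist-unique : ∀ {U x y d d′} → Dist G U x y d → Dist G U x y d′ → d ≡ d′
  Dist-unique {d = just a}  {just b}  (w , a≤) (w′ , b≤) = cong just (ℚₚ.≤-antisym (a≤ b w′) (b≤ a w))
  Dist-unique {d = just a}  {nothing} (w , _)  ¬w′       = contradiction w (¬w′ a)
  Dist-unique {d = nothing} {just b}  ¬w       (w′ , _)  = contradiction w′ (¬w b)
  Dist-unique {d = nothing} {nothing} _        _         = refl

  RT-unique : ∀ {U x y d d′} → RT G U x y d → RT G U x y d′ → d ≡ d′
  RT-unique (_ , _ , D₁ , D₂ , refl) (_ , _ , D₁′ , D₂′ , refl) =
    cong₂ _+∞_ (Dist-unique D₁ D₁′) (Dist-unique D₂ D₂′)

  ball⊆closedBall : ∀ {U u r v} → InBall G U u r v → InCBall G U u r v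
  ball⊆closedBall (v∈U , just a , rt , fin<fin a<r) = v∈U , just a , rt , fin≤fin (ℚₚ.<⇒≤ a<r)

  -- Distances are not computable from their specification; a ball inside a ball represented by
  -- a subset is decided by comparing the radius with the distance its members come with.
  ball-dec : ∀ {U u r r′ B} → Represents G (InBall G U u r′) B →
             (∀ {v} → InBall G U u r v → InBall G U u r′ v) → Decidable (InBall G U u r)
  ball-dec {U} {u} {r} {B = B} repB ball⊆ v with v ∈? B
  ... | no v∉B = no (v∉B ∘ Equivalence.from (repB v) ∘ ball⊆)
  ... | yes v∈B with Equivalence.to (repB v) v∈B
  ...   | v∈U , nothing , _  , ()
  ...   | v∈U , just a  , rt , _ = Dec.map′ (λ a<r → v∈U , just a , rt , fin<fin a<r) a<r (a ℚ.<? r)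
    where
    a<r : InBall G U u r v → a ℚ.< r
    a<r (_ , d , rt′ , d<r) with RT-unique rt′ rt | d<r
    ... | refl | fin<fin a<r = a<r

  OutSPT⇒∣T∣≤∣B∣ : ∀ {U u B T} → OutSPT G U u B T → ∣ T ∣ ≤ ∣ B ∣
  OutSPT⇒∣T∣≤∣B∣ (edges , _ , unique-parent) =
    unique-in-edge⇒∣T∣≤∣B∣ (proj₁ ∘ proj₂ ∘ edges _ _) (unique-parent _ _ _)

  InSPT⇒∣T∣≤∣B∣ : ∀ {U u B T} → InSPT G U u B T → ∣ T ∣ ≤ ∣ B ∣
  InSPT⇒∣T∣≤∣B∣ (edges , _ , unique-parent) =
    unique-out-edge⇒∣T∣≤∣B∣ (proj₁ ∘ proj₂ ∘ edges _ _) (unique-parent _ _ _)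

NonNegWeights : ∀ {n} → Graph n → Set
NonNegWeights G = ∀ a b c → G a b ≡ just c → 0ℚ ℚ.≤ c

module _ {n} {G : Graph n} (w≥0 : NonNegWeights G) where

  Walk-nonNeg : ∀ {U x y l} → Walk G U x y l → 0ℚ ℚ.≤ l
  Walk-nonNeg (here _)     = ℚₚ.≤-refl
  Walk-nonNeg (step _ e w) = ℚₚ.+-mono-≤ (w≥0 _ _ _ e) (Walk-nonNeg w)

  RT-nonNeg : ∀ {U x y a} → RT G U x y (just a) → 0ℚ ℚ.≤ a
  RT-nonNeg (just _ , just _  , (w₁ , _) , (w₂ , _) , refl) = ℚₚ.+-mono-≤ (Walk-nonNeg w₁) (Walk-nonNeg w₂)
  RT-nonNeg (just _ , nothing , _ , _ , ())
  RT-nonNeg (nothing , _      , _ , _ , ())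

  centre∈closedBall : ∀ {U u r} → u ∈ U → 0ℚ ℚ.≤ r → InCBall G U u r u
  centre∈closedBall u∈U 0≤r = u∈U , just 0ℚ , (just 0ℚ , just 0ℚ , dist₀ , dist₀ , refl) , fin≤fin 0≤r
    where dist₀ = here u∈U , λ _ → Walk-nonNeg

  ball⊆nextBall : ∀ {U u s v} j → InBall G U u (ℕ→ℚ j ℚ.* s) v → InBall G U u (ℕ→ℚ (suc j) ℚ.* s) v
  ball⊆nextBall j (v∈U , just a , rt , fin<fin a<js) =
    v∈U , just a , rt , fin<fin (a<j*s⇒a<[1+j]*s j (RT-nonNeg rt) a<js)

  closedBall⊆R⇒nʰ≤∣R∣ᵏ : ∀ {U u s h B R} k → u ∈ U →
                           (∀ j c → 1 ≤ j → j < suc h →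
                              HasCard G (InBall G U u (ℕ→ℚ j ℚ.* s)) c → n ^ j ≤ c ^ k) →
                           Represents G (InBall G U u (ℕ→ℚ (suc h) ℚ.* s)) B →
                           (∀ {v} → InCBall G U u (ℕ→ℚ h ℚ.* s) v → v ∈ R) →
                           n ^ h ≤ ∣ R ∣ ^ k
  closedBall⊆R⇒nʰ≤∣R∣ᵏ {s = s} {zero} {R = R} k u∈U _ _ closedBall⊆R =
    m^n>0 ∣ R ∣ {{>-nonZero (≤-<-trans z≤n (x∈p⇒∣p-x∣<∣p∣ u∈R))}} k
    where u∈R = closedBall⊆R (centre∈closedBall u∈U (ℚₚ.≤-reflexive (sym (ℚₚ.*-zeroˡ s))))
  closedBall⊆R⇒nʰ≤∣R∣ᵏ {h = suc h} {R = R} k u∈U minimal repB closedBall⊆R = begin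
    n ^ suc h    ≤⟨ minimal (suc h) ∣ S ∣ (s≤s z≤n) ≤-refl (S , ∈decSubset⇔ ball? , refl) ⟩
    ∣ S ∣ ^ k    ≤⟨ ^-monoˡ-≤ k (p⊆q⇒∣p∣≤∣q∣ S⊆R) ⟩
    ∣ R ∣ ^ k    ∎
    where
    open ≤-Reasoning
    ball? = ball-dec G repB (ball⊆nextBall (suc h))
    S = decSubset ball?
    S⊆R : S ⊆ R
    S⊆R {v} v∈S = closedBall⊆R (ball⊆closedBall G (Equivalence.to (∈decSubset⇔ ball? v) v∈S))

  CoverStep-potential : ∀ {k L c U Ê U′ Ê′} → n ≤ c ^ k → CoverStep G k L U Ê U′ Ê′ →
                        ∣ Ê′ ∣ + 2 * c * ∣ U′ ∣ ≤ ∣ Ê ∣ + 2 * c * ∣ U ∣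
  CoverStep-potential {k} {c = c} {U} {Ê} {U′} n≤cᵏ
    (_ , u∈U , _ , _ , _ , suc h , _ , minimal , B , repB , ∣B∣ᵏ<nʰ ,
     Tout , Tin , out , in′ , refl , repU′) =
    begin
      ∣ (Ê ∪ Tout) ∪ Tin ∣ + 2 * c * ∣ U′ ∣          ≤⟨ +-monoˡ-≤ (2 * c * ∣ U′ ∣) grown ⟩
      ∣ Ê ∣ + ∣ B ∣ + ∣ B ∣ + 2 * c * ∣ U′ ∣         ≤⟨ +-monoˡ-≤ (2 * c * ∣ U′ ∣)
                                                          (+-mono-≤ (+-monoʳ-≤ ∣ Ê ∣ ∣B∣≤c∣R∣) ∣B∣≤c∣R∣) ⟩
      ∣ Ê ∣ + c * ∣ R ∣ + c * ∣ R ∣ + 2 * c * ∣ U′ ∣ ≡⟨ regroup (∣ Ê ∣) c (∣ R ∣) (∣ U′ ∣) ⟩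
      ∣ Ê ∣ + 2 * c * (∣ U′ ∣ + ∣ R ∣)               ≡⟨ cong (λ m → ∣ Ê ∣ + 2 * c * m) ∣U∣≡∣U′∣+∣R∣ ⟨
      ∣ Ê ∣ + 2 * c * ∣ U ∣                          ∎
    where
    open ≤-Reasoning
    R = U ─ U′

    grown : ∣ (Ê ∪ Tout) ∪ Tin ∣ ≤ ∣ Ê ∣ + ∣ B ∣ + ∣ B ∣
    grown = begin
      ∣ (Ê ∪ Tout) ∪ Tin ∣      ≤⟨ ∣p∪q∣≤∣p∣+∣q∣ (Ê ∪ Tout) Tin ⟩
      ∣ Ê ∪ Tout ∣ + ∣ Tin ∣    ≤⟨ +-mono-≤ (∣p∪q∣≤∣p∣+∣q∣ Ê Tout) (InSPT⇒∣T∣≤∣B∣ G in′) ⟩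
      ∣ Ê ∣ + ∣ Tout ∣ + ∣ B ∣  ≤⟨ +-monoˡ-≤ ∣ B ∣ (+-monoʳ-≤ ∣ Ê ∣ (OutSPT⇒∣T∣≤∣B∣ G out)) ⟩
      ∣ Ê ∣ + ∣ B ∣ + ∣ B ∣     ∎

    removed : n ^ h ≤ ∣ R ∣ ^ k
    removed = closedBall⊆R⇒nʰ≤∣R∣ᵏ k u∈U minimal repB λ {v} v∈ →
      x∈p∧x∉q⇒x∈p─q (proj₁ v∈) (λ v∈U′ → proj₂ (Equivalence.to (repU′ v) v∈U′) v∈)

    ∣B∣≤c∣R∣ : ∣ B ∣ ≤ c * ∣ R ∣
    ∣B∣≤c∣R∣ = <⇒≤ (^-cancelˡ-< k (begin-strict
      ∣ B ∣ ^ k            <⟨ ∣B∣ᵏ<nʰ ⟩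
      n * n ^ h            ≤⟨ *-mono-≤ n≤cᵏ removed ⟩
      c ^ k * ∣ R ∣ ^ k    ≡⟨ ^-distribʳ-* c ∣ R ∣ k ⟨
      (c * ∣ R ∣) ^ k      ∎))

    ∣U∣≡∣U′∣+∣R∣ : ∣ U ∣ ≡ ∣ U′ ∣ + ∣ R ∣
    ∣U∣≡∣U′∣+∣R∣ = q⊆p⇒∣p∣≡∣q∣+∣p─q∣ (λ {v} v∈U′ → proj₁ (Equivalence.to (repU′ v) v∈U′))

    regroup : ∀ e c r u → e + c * r + c * r + 2 * c * u ≡ e + 2 * c * (u + r)
    regroup = solve-∀

  CoverRun-potential : ∀ {k L c U Ê Ê′} → n ≤ c ^ k → CoverRun G k L U Ê Ê′ →
                       ∣ Ê′ ∣ ≤ ∣ Ê ∣ + 2 * c * ∣ U ∣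
  CoverRun-potential {Ê = Ê} _    (done _)              = m≤m+n ∣ Ê ∣ _
  CoverRun-potential         n≤cᵏ (iter iteration rest) =
    ≤-trans (CoverRun-potential n≤cᵏ rest) (CoverStep-potential n≤cᵏ iteration)

CoverOutput-size : ∀ {n} {G : Graph n} {k L ε Ê} .{{_ : NonZero k}} → NonNegWeights G →
                   CoverOutput G k L ε Ê → ∣ Ê ∣ ^ k ≤ 4 ^ k * n ^ (k + 1)
CoverOutput-size {n} {k = k} {Ê = Ê} w≥0 cover with floor-root k n
... | t , tᵏ≤n , n<[1+t]ᵏ = m≤2[1+t]n⇒mᵏ≤4ᵏnᵏ⁺¹ k tᵏ≤n n<[1+t]ᵏ (begin
  ∣ Ê ∣                                  ≤⟨ CoverRun-potential w≥0 (<⇒≤ n<[1+t]ᵏ) cover ⟩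
  ∣ ⊥ {n * n} ∣ + 2 * suc t * ∣ ⊤ {n} ∣  ≡⟨ cong₂ (λ e v → e + 2 * suc t * v) (∣⊥∣≡0 (n * n)) (∣⊤∣≡n n) ⟩
  2 * suc t * n                          ∎)
  where open ≤-Reasoning

lemma3 : ∃[ C ] (∀ (n : ℕ) (G : Graph n) (W : ℚ) (k : ℕ) (L ε : ℚ) →
           (∀ a b c → G a b ≡ just c → (1ℚ ℚ.≤ c) × (c ℚ.≤ W)) →
           2 ≤ k → 0ℚ ℚ.< L → 0ℚ ℚ.< ε →
           ε ℚ.* ℕ→ℚ (2 * k ∸ 2) ℚ.≤ 1ℚ →
           (Ê : EdgeSet G) → CoverOutput G k L ε Ê →
           ∣ Ê ∣ ^ k ≤ C ^ k * n ^ (k + 1))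
lemma3 = 4 , λ n G W k L ε w∈[1,W] 2≤k _ _ _ Ê cover →
  CoverOutput-size {ε = ε} {{>-nonZero (≤-trans (s≤s z≤n) 2≤k)}}
    (λ a b c e → ℚₚ.≤-trans (ℚₚ.<⇒≤ (ℚₚ.positive⁻¹ 1ℚ)) (proj₁ (w∈[1,W] a b c e))) cover
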